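{- Fix $n \ge 1$ and $k \ge 2$, and let $\pi \in S_n(123, 132, (k-1)(k-2)\ldots 1\,k)$. Writing $j = \pi^{ -1}(n)$, $\pi$ has the form $$n-1,\ n-2,\ \ldots,\ n-j+1,\ n,\ \sigma$$ for some $\sigma \in S_{n-j}(123, 132, (k-1)(k-2)\ldots 1\,k)$.
   Context: Permutations of $[n]$ are written in one-line notation, and $S_n$ denotes the set of them; $\pi^{ -1}(n)$ is the position of the entry $n$. A permutation $\pi\in S_n$ contains $\sigma\in S_m$ if there are indices $i_1<\dots<i_m$ such that for all $a,b$, $\pi(i_a)<\pi(i_b)$ iff $\sigma(a)<\sigma(b)$; otherwise $\pi$ avoids $\sigma$. For a set $R$ of permutations, $S_n(R)$ is the set of $\pi\in S_n$ avoiding every element of $R$; $S_0(R)$ consists of the empty permutation only. The permutation $(k-1)(k-2)\ldots 1\,k\in S_k$ lists $k-1,\dots,1$ in decreasing order followed by $k$. -}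

module Defs where

open import Data.Nat using (ℕ; zero; suc; _+_; _∸_; _≤_; _<_; _<?_)
open import Data.Nat.Properties using (_≟_)
open import Data.Fin using (Fin; toℕ; fromℕ<)
open import Data.Product using (Σ; _×_; ∃)
open import Data.List using (List; []; _∷_)
open import Data.List.Relation.Unary.All using (All)
open import Function using (_⇔_)
open import Function.Definitions using (Injective)
open import Relation.Binary.PropositionalEquality using (_≡_)
open import Relation.Nullary using (¬_; yes; no)

-- A permutation of [n] = {1,…,n} in one-line notation: position i (a Fin n,
-- i.e. the 1-based position toℕ i + 1) holds the entry  word i ∈ {1,…,n},
-- and distinct positions hold distinct entries.  (This is S_n.)
record Perm (n : ℕ) : Set where
  field
    word  : Fin n → ℕ
    lower : ∀ i → 1 ≤ word i
    upper : ∀ i → word i ≤ n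
    inj   : Injective _≡_ _≡_ word
open Perm public

-- Entry at the 1-based position i (junk value 0 when i ∉ [1,n]).
_‼_ : ∀ {n} → Perm n → ℕ → ℕ
_‼_ {n} π zero = 0
_‼_ {n} π (suc i) with i <? n
... | yes i<n = word π (fromℕ< i<n)
... | no _    = 0

Contains : ∀ {n m} → Perm n → (Fin m → ℕ) → Set
Contains {n} {m} π σ =
  Σ (Fin m → Fin n) λ ι →
    (∀ (a b : Fin m) → toℕ a < toℕ b → toℕ (ι a) < toℕ (ι b)) ×
    (∀ (a b : Fin m) → (word π (ι a) < word π (ι b)) ⇔ (σ a < σ b))

Avoids : ∀ {n m} → Perm n → (Fin m → ℕ) → Set
Avoids π σ = ¬ Contains π σ

p123 : Fin 3 → ℕ
p123 i = suc (toℕ i)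

p132 : Fin 3 → ℕ
p132 Fin.zero = 1
p132 (Fin.suc Fin.zero) = 3
p132 (Fin.suc (Fin.suc Fin.zero)) = 2

-- The pattern (k-1)(k-2)…1 k ∈ S_k: 1-based position p < k holds k - p,
-- position k holds k.
decMax : (k : ℕ) → Fin k → ℕ
decMax k i with suc (toℕ i) ≟ k
... | yes _ = k
... | no _  = k ∸ suc (toℕ i)

AvoidsAll : ∀ {n} → ℕ → Perm n → Set
AvoidsAll k π = Avoids π p123 × Avoids π p132 × Avoids π (decMax k)

-- With n at position j, avoiding 123 forces the entries before it to decrease, and
-- avoiding 132 forces each of them to exceed every entry after it.  So the first
-- j - 1 entries are the j - 1 largest values below n, in decreasing order, and the
-- entries after position j form a permutation of {1, …, n - j}, which inherits every
-- avoided pattern from π.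
module Submission where

open import Defs
open import Data.Nat using (ℕ; zero; suc; _+_; _∸_; _≤_; _<_; s≤s; s≤s⁻¹; _<?_; >-nonZero)
open import Data.Nat.Properties
open import Data.Fin using (Fin; toℕ; fromℕ<; inject₁; punchOut) renaming (zero to fz; suc to fs)
import Data.Fin.Properties as Fin
open import Data.Fin.Induction using (<-weakInduction)
open import Data.Product using (Σ; _×_; _,_; ∃)
open import Data.Sum using (inj₁; inj₂)
open import Function using (_∘_; mk⇔)
open import Function.Definitions using (Injective)
open import Relation.Binary.Definitions using (Transitive; tri<; tri≈; tri>)
open import Relation.Binary.PropositionalEquality
open import Relation.Nullary using (¬_; yes; no; contradiction)
open import Relation.Nullary.Decidable using (toWitness; _→-dec_)

‼-word : ∀ {n} (π : Perm n) (q : Fin n) {m} → toℕ q ≡ m → π ‼ suc m ≡ word π q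
‼-word {n} π q refl with toℕ q <? n
... | yes q<n = cong (word π) (Fin.fromℕ<-toℕ q q<n)
... | no q≮n = contradiction (Fin.toℕ<n q) q≮n

word-≮⇒> : ∀ {n} (π : Perm n) {a b} → a ≢ b → ¬ word π a < word π b → word π b < word π a
word-≮⇒> π a≢b wa≮wb = ≤∧≢⇒< (≮⇒≥ wa≮wb) (a≢b ∘ inj π ∘ sym)

-- If the value v were missed, the entries minus one would inject Fin n into the
-- n - 1 slots of Fin n other than v - 1.
word-surjective : ∀ {n} (π : Perm n) {v} → 1 ≤ v → v ≤ n → ∃ λ q → word π q ≡ v
word-surjective {suc n} π {suc v} _ (s≤s v≤n) with Fin.any? (λ q → word π q ≟ suc v)
... | yes hit = hit
... | no miss = contradiction (Fin.injective⇒≤ squeeze-injective) 1+n≰n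
  where
  slot : Fin (suc n) → Fin (suc n)
  slot q = fromℕ< (s≤s (pred-mono-≤ (upper π q)))

  suc-slot : ∀ q → suc (toℕ (slot q)) ≡ word π q
  suc-slot q = trans (cong suc (Fin.toℕ-fromℕ< _)) (suc-pred _ {{>-nonZero (lower π q)}})

  target : Fin (suc n)
  target = fromℕ< (s≤s v≤n)

  target≢slot : ∀ q → target ≢ slot q
  target≢slot q eq =
    miss (q , trans (sym (suc-slot q)) (cong suc (trans (cong toℕ (sym eq)) (Fin.toℕ-fromℕ< _))))

  squeeze : Fin (suc n) → Fin n
  squeeze q = punchOut (target≢slot q)

  squeeze-injective : Injective _≡_ _≡_ squeeze
  squeeze-injective {a} {b} eq = inj π (begin
    word π a                  ≡⟨ sym (suc-slot a) ⟩
    suc (toℕ (slot a))        ≡⟨ cong (suc ∘ toℕ) (Fin.punchOut-injective (target≢slot a) (target≢slot b) eq) ⟩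
    suc (toℕ (slot b))        ≡⟨ suc-slot b ⟩
    word π b                  ∎)
    where open ≡-Reasoning

embedding⇒contains : ∀ {n m} (π : Perm n) {σ : Fin m → ℕ} (ι : Fin m → Fin n) →
  Injective _≡_ _≡_ σ →
  (∀ a b → toℕ a < toℕ b → toℕ (ι a) < toℕ (ι b)) →
  (∀ a b → σ a < σ b → word π (ι a) < word π (ι b)) →
  Contains π σ
embedding⇒contains π {σ} ι σ-injective ι-increasing forward =
  ι , ι-increasing , λ a b → mk⇔ (backward a b) (forward a b)
  where
  backward : ∀ a b → word π (ι a) < word π (ι b) → σ a < σ b
  backward a b lt with <-cmp (σ a) (σ b)
  ... | tri< σa<σb _ _ = σa<σb
  ... | tri≈ _ σa≡σb _ = contradiction lt (<-irrefl (cong (word π ∘ ι) (σ-injective σa≡σb)))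
  ... | tri> _ _ σb<σa = contradiction lt (<-asym (forward b a σb<σa))

triple : ∀ {A : Set} → A → A → A → Fin 3 → A
triple x y z fz = x
triple x y z (fs fz) = y
triple x y z (fs (fs fz)) = z

triple-increasing : ∀ {A : Set} {_≺_ : A → A → Set} → Transitive _≺_ →
  ∀ {x y z} → x ≺ y → y ≺ z → ∀ a b → toℕ a < toℕ b → triple x y z a ≺ triple x y z b
triple-increasing ≺-trans x≺y y≺z fz (fs fz) _ = x≺y
triple-increasing ≺-trans x≺y y≺z fz (fs (fs fz)) _ = ≺-trans x≺y y≺z
triple-increasing ≺-trans x≺y y≺z (fs fz) (fs (fs fz)) _ = y≺z
triple-increasing _ _ _ fz fz ()
triple-increasing _ _ _ (fs fz) fz ()
triple-increasing _ _ _ (fs fz) (fs fz) (s≤s ())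
triple-increasing _ _ _ (fs (fs fz)) fz ()
triple-increasing _ _ _ (fs (fs fz)) (fs fz) (s≤s ())
triple-increasing _ _ _ (fs (fs fz)) (fs (fs fz)) (s≤s (s≤s ()))

p132-injective : Injective _≡_ _≡_ p132
p132-injective {a} {b} =
  toWitness {a? = Fin.all? λ a → Fin.all? λ b → p132 a ≟ p132 b →-dec a Fin.≟ b} _ a b

module _ {n} (π : Perm n) {x y z : Fin n} (x<y : toℕ x < toℕ y) (y<z : toℕ y < toℕ z) where

  private
    positions-increasing : ∀ a b → toℕ a < toℕ b → toℕ (triple x y z a) < toℕ (triple x y z b)
    positions-increasing = triple-increasing {_≺_ = λ i j → toℕ i < toℕ j} <-trans x<y y<z

  contains-123 : word π x < word π y → word π y < word π z → Contains π p123
  contains-123 wx<wy wy<wz =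
    embedding⇒contains π (triple x y z) (Fin.toℕ-injective ∘ suc-injective) positions-increasing
      λ a b → triple-increasing {_≺_ = λ i j → word π i < word π j} <-trans wx<wy wy<wz a b ∘ s≤s⁻¹

  contains-132 : word π x < word π z → word π z < word π y → Contains π p132
  contains-132 wx<wz wz<wy =
    embedding⇒contains π (triple x y z) p132-injective positions-increasing forward
    where
    forward : ∀ a b → p132 a < p132 b → word π (triple x y z a) < word π (triple x y z b)
    forward fz (fs fz) _ = <-trans wx<wz wz<wy
    forward fz (fs (fs fz)) _ = wx<wz
    forward (fs (fs fz)) (fs fz) _ = wz<wy
    forward fz fz (s≤s ())
    forward (fs fz) fz (s≤s ())
    forward (fs fz) (fs fz) (s≤s (s≤s (s≤s ())))
    forward (fs fz) (fs (fs fz)) (s≤s (s≤s ()))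
    forward (fs (fs fz)) fz (s≤s ())
    forward (fs (fs fz)) (fs (fs fz)) (s≤s (s≤s ()))

module Suffix {n} (π : Perm n) (s : ℕ) (s≤n : s ≤ n)
              (bounded : ∀ q → s ≤ toℕ q → word π q ≤ n ∸ s) where

  shift : Fin (n ∸ s) → Fin n
  shift t = fromℕ< (begin-strict
    s + toℕ t   <⟨ +-monoʳ-< s (Fin.toℕ<n t) ⟩
    s + (n ∸ s) ≡⟨ m+[n∸m]≡n s≤n ⟩
    n           ∎)
    where open ≤-Reasoning

  toℕ-shift : ∀ t → toℕ (shift t) ≡ s + toℕ t
  toℕ-shift t = Fin.toℕ-fromℕ< _

  shift-injective : Injective _≡_ _≡_ shift
  shift-injective {t} {u} eq = Fin.toℕ-injective (+-cancelˡ-≡ s _ _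
    (trans (sym (toℕ-shift t)) (trans (cong toℕ eq) (toℕ-shift u))))

  suffix : Perm (n ∸ s)
  suffix = record
    { word  = word π ∘ shift
    ; lower = lower π ∘ shift
    ; upper = λ t → bounded (shift t) (subst (s ≤_) (sym (toℕ-shift t)) (m≤m+n s (toℕ t)))
    ; inj   = shift-injective ∘ inj π
    }

  ‼-suffix : ∀ t → 1 ≤ t → t ≤ n ∸ s → π ‼ (s + t) ≡ suffix ‼ t
  ‼-suffix (suc t) _ t<n∸s = begin
    π ‼ (s + suc t) ≡⟨ cong (π ‼_) (+-suc s t) ⟩
    π ‼ suc (s + t) ≡⟨ ‼-word π (shift u) (trans (toℕ-shift u) (cong (s +_) toℕ-u)) ⟩
    word suffix u   ≡⟨ sym (‼-word suffix u toℕ-u) ⟩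
    suffix ‼ suc t  ∎
    where
    open ≡-Reasoning
    u = fromℕ< t<n∸s
    toℕ-u = Fin.toℕ-fromℕ< t<n∸s

  contains-suffix : ∀ {m} {σ : Fin m → ℕ} → Contains suffix σ → Contains π σ
  contains-suffix (ι , ι-increasing , order) =
    shift ∘ ι , shift-increasing , order
    where
    shift-increasing : ∀ a b → toℕ a < toℕ b → toℕ (shift (ι a)) < toℕ (shift (ι b))
    shift-increasing a b a<b = subst₂ _<_ (sym (toℕ-shift (ι a))) (sym (toℕ-shift (ι b)))
      (+-monoʳ-< s (ι-increasing a b a<b))

module MaximumAt {n} (π : Perm (suc n)) (p : Fin (suc n)) (π[p]≡max : word π p ≡ suc n)
                 (avoid123 : Avoids π p123) (avoid132 : Avoids π p132) where

  below-max : ∀ {q} → q ≢ p → word π q < suc n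
  below-max q≢p = ≤∧≢⇒< (upper π _) λ wq≡max → q≢p (inj π (trans wq≡max (sym π[p]≡max)))

  below-π[p] : ∀ {q} → q ≢ p → word π q < word π p
  below-π[p] q≢p = <-≤-trans (below-max q≢p) (≤-reflexive (sym π[p]≡max))

  prefix-decreasing : ∀ {a b} → toℕ a < toℕ b → toℕ b < toℕ p → word π b < word π a
  prefix-decreasing a<b b<p = word-≮⇒> π (Fin.<⇒≢ a<b) λ wa<wb →
    avoid123 (contains-123 π a<b b<p wa<wb (below-π[p] (Fin.<⇒≢ b<p)))

  prefix-above-suffix : ∀ {a b} → toℕ a < toℕ p → toℕ p < toℕ b → word π b < word π a
  prefix-above-suffix a<p p<b = word-≮⇒> π (Fin.<⇒≢ (<-trans a<p p<b)) λ wa<wb →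
    avoid132 (contains-132 π a<p p<b wa<wb (below-π[p] (Fin.<⇒≢ p<b ∘ sym)))

  prefix-above-later : ∀ {a q} → toℕ a < toℕ p → toℕ a < toℕ q → q ≢ p → word π q < word π a
  prefix-above-later {q = q} a<p a<q q≢p with Fin.<-cmp q p
  ... | tri< q<p _ _ = prefix-decreasing a<q q<p
  ... | tri≈ _ q≡p _ = contradiction q≡p q≢p
  ... | tri> _ _ p<q = prefix-above-suffix a<p p<q

  prefix-antitone : ∀ {a b} → toℕ a ≤ toℕ b → toℕ b < toℕ p → word π b ≤ word π a
  prefix-antitone a≤b b<p with m≤n⇒m<n∨m≡n a≤b
  ... | inj₁ a<b = <⇒≤ (prefix-decreasing a<b b<p)
  ... | inj₂ a≡b = ≤-reflexive (cong (word π) (Fin.toℕ-injective (sym a≡b)))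

  -- The value n - a is taken somewhere; positions before a carry larger values and
  -- positions after a (other than p) smaller ones than word π a, so it is taken at a.
  prefix-entry-by-bounds : ∀ a → toℕ a < toℕ p → word π a ≤ n ∸ toℕ a →
    (∀ q → toℕ q < toℕ a → n ∸ toℕ a < word π q) → word π a ≡ n ∸ toℕ a
  prefix-entry-by-bounds a a<p upper-bound earlier-above
    with word-surjective π {n ∸ toℕ a} (m<n⇒0<n∸m (<-≤-trans a<p (s≤s⁻¹ (Fin.toℕ<n p))))
                         (m≤n⇒m≤1+n (m∸n≤m n (toℕ a)))
  ... | q , wq≡v with Fin.<-cmp q a
  ... | tri< q<a _ _ = contradiction (earlier-above q q<a) (<-irrefl (sym wq≡v))
  ... | tri≈ _ refl _ = wq≡v
  ... | tri> _ _ a<q =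
    contradiction (<-≤-trans (prefix-above-later a<p a<q q≢p) upper-bound) (<-irrefl wq≡v)
    where
    q≢p : q ≢ p
    q≢p refl = 1+n≰n (≤-trans (≤-reflexive (trans (sym π[p]≡max) wq≡v)) (m∸n≤m n (toℕ a)))

  below-entry : ∀ {a q} → word π a ≡ n ∸ toℕ a → toℕ a < toℕ p → toℕ a < toℕ q → q ≢ p →
    word π q ≤ n ∸ suc (toℕ a)
  below-entry {a} {q} wa≡ a<p a<q q≢p = subst (word π q ≤_) (pred[m∸n]≡m∸[1+n] n (toℕ a))
    (suc[m]≤n⇒m≤pred[n] (subst (word π q <_) wa≡ (prefix-above-later a<p a<q q≢p)))

  prefix-entry : ∀ a → toℕ a < toℕ p → word π a ≡ n ∸ toℕ a
  prefix-entry = <-weakInduction (λ a → toℕ a < toℕ p → word π a ≡ n ∸ toℕ a) first next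
    where
    first : 0 < toℕ p → word π fz ≡ n
    first 0<p = prefix-entry-by-bounds fz 0<p (s≤s⁻¹ (below-max (Fin.<⇒≢ 0<p))) λ _ ()

    next : ∀ i → (toℕ (inject₁ i) < toℕ p → word π (inject₁ i) ≡ n ∸ toℕ (inject₁ i)) →
      suc (toℕ i) < toℕ p → word π (fs i) ≡ n ∸ suc (toℕ i)
    next i entry-before i+1<p = prefix-entry-by-bounds (fs i) i+1<p upper-bound earlier-above
      where
      i≡i′ : toℕ (inject₁ i) ≡ toℕ i
      i≡i′ = Fin.toℕ-inject₁ i

      i′<p : toℕ (inject₁ i) < toℕ p
      i′<p = subst (_< toℕ p) (sym i≡i′) (<-trans (n<1+n (toℕ i)) i+1<p)

      w[i′] : word π (inject₁ i) ≡ n ∸ toℕ (inject₁ i)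
      w[i′] = entry-before i′<p

      upper-bound : word π (fs i) ≤ n ∸ suc (toℕ i)
      upper-bound = subst (λ m → word π (fs i) ≤ n ∸ suc m) i≡i′
        (below-entry w[i′] i′<p (subst (_< suc (toℕ i)) (sym i≡i′) (n<1+n (toℕ i)))
          (Fin.<⇒≢ i+1<p))

      earlier-above : ∀ q → toℕ q < suc (toℕ i) → n ∸ suc (toℕ i) < word π q
      earlier-above q q≤i = begin-strict
        n ∸ suc (toℕ i)       <⟨ ∸-monoʳ-< (n<1+n (toℕ i)) (s≤s⁻¹ (<-trans i+1<p (Fin.toℕ<n p))) ⟩
        n ∸ toℕ i             ≡⟨ trans (cong (n ∸_) (sym i≡i′)) (sym w[i′]) ⟩
        word π (inject₁ i)    ≤⟨ prefix-antitone (subst (toℕ q ≤_) (sym i≡i′) (s≤s⁻¹ q≤i)) i′<p ⟩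
        word π q              ∎
        where open ≤-Reasoning

  private
    position : ∀ {m} → m < toℕ p → Fin (suc n)
    position m<p = fromℕ< (<-trans m<p (Fin.toℕ<n p))

    toℕ-position : ∀ {m} (m<p : m < toℕ p) → toℕ (position m<p) ≡ m
    toℕ-position m<p = Fin.toℕ-fromℕ< (<-trans m<p (Fin.toℕ<n p))

    position<p : ∀ {m} (m<p : m < toℕ p) → toℕ (position m<p) < toℕ p
    position<p m<p = subst (_< toℕ p) (sym (toℕ-position m<p)) m<p

  prefix-‼ : ∀ m → m < toℕ p → π ‼ suc m ≡ n ∸ m
  prefix-‼ m m<p = begin
    π ‼ suc m                    ≡⟨ ‼-word π (position m<p) (toℕ-position m<p) ⟩
    word π (position m<p)        ≡⟨ prefix-entry (position m<p) (position<p m<p) ⟩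
    n ∸ toℕ (position m<p)       ≡⟨ cong (n ∸_) (toℕ-position m<p) ⟩
    n ∸ m                        ∎
    where open ≡-Reasoning

  suffix-bounded : ∀ q → toℕ p < toℕ q → word π q ≤ n ∸ toℕ p
  suffix-bounded q p<q = ceiling (toℕ p) ≤-refl
    where
    q≢p : q ≢ p
    q≢p = Fin.<⇒≢ p<q ∘ sym

    ceiling : ∀ m → m ≤ toℕ p → word π q ≤ n ∸ m
    ceiling zero _ = s≤s⁻¹ (below-max q≢p)
    ceiling (suc m) m<p = subst (λ k → word π q ≤ n ∸ suc k) (toℕ-position m<p)
      (below-entry (prefix-entry _ a<p) a<p (<-trans a<p p<q) q≢p)
      where
      a<p = position<p m<p

lemma3p8 : (n k : ℕ) → 1 ≤ n → 2 ≤ k → (π : Perm n) → AvoidsAll k π →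
    (p : Fin n) → word π p ≡ n →
      (∀ i → 1 ≤ i → i < toℕ p + 1 → π ‼ i ≡ n ∸ i) ×
      Σ (Perm (n ∸ (toℕ p + 1))) (λ σ → AvoidsAll k σ ×
        (∀ t → 1 ≤ t → t ≤ n ∸ (toℕ p + 1) → π ‼ (toℕ p + 1 + t) ≡ σ ‼ t))
lemma3p8 zero _ () _ _ _ _ _
lemma3p8 (suc n) k _ _ π (avoid123 , avoid132 , avoidK) p π[p]≡max =
  prefix ,
  suffix , (avoid123 ∘ contains-suffix , avoid132 ∘ contains-suffix , avoidK ∘ contains-suffix) ,
  ‼-suffix
  where
  open MaximumAt π p π[p]≡max avoid123 avoid132

  p+1≡1+p : toℕ p + 1 ≡ suc (toℕ p)
  p+1≡1+p = +-comm (toℕ p) 1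

  open Suffix π (toℕ p + 1) (subst (_≤ suc n) (sym p+1≡1+p) (Fin.toℕ<n p))
    (λ q p+1≤q → subst (λ s → word π q ≤ suc n ∸ s) (sym p+1≡1+p)
      (suffix-bounded q (subst (_≤ toℕ q) p+1≡1+p p+1≤q)))

  prefix : ∀ i → 1 ≤ i → i < toℕ p + 1 → π ‼ i ≡ suc n ∸ i
  prefix (suc m) _ m+1<p+1 = prefix-‼ m (s≤s⁻¹ (subst (suc m <_) p+1≡1+p m+1<p+1))
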